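{- Let $P\subset\mathbb{R}^d$ be a lattice-face $d$-simplex with vertices $v_1,\dots,v_{d+1}$ and let $\sigma\in\mathfrak{S}_d$. Then the map $T_\sigma:\mathbb{R}^d\to\mathbb{R}^d$, $$T_\sigma(\mathbf{x})=\Big(\frac{\det\tilde X(\sigma,1;\mathbf{x})}{\det Y(\sigma,1)},\frac{\det\tilde X(\sigma,2;\mathbf{x})}{\det Y(\sigma,2)},\dots,\frac{\det\tilde X(\sigma,d;\mathbf{x})}{\det Y(\sigma,d)}\Big),$$ is a lattice-preserving affine transformation, i.e. an invertible affine map of $\mathbb{R}^d$ mapping lattice points to lattice points.
   Context: Write $v_i=(x_{i,1},\dots,x_{i,d})$. For $\mathbf{x}=(x_1,\dots,x_d)$ and $1\le k\le d$, $\tilde X(\sigma,k;\mathbf{x})$ is the $(k+1)\times(k+1)$ matrix with rows $(1,x_{\sigma(r),1},\dots,x_{\sigma(r),k})$ for $r=1,\dots,k$ followed by $(1,x_1,\dots,x_k)$; $Y(\sigma,k)$ is the $k\times k$ matrix with rows $(1,x_{\sigma(r),1},\dots,x_{\sigma(r),k-1})$, $r=1,\dots,k$. Lattice-face polytopes are defined recursively with $\pi:\mathbb{R}^n\to\mathbb{R}^{n-1}$ forgetting the last coordinate: a $1$-dimensional polytope is lattice-face if it is integral; for $n\ge2$, an $n$-polytope with vertex set $V$ is lattice-face if for every $n$-subset $U\subset V$, $\pi(\mathrm{conv}(U))$ is a lattice-face $(n-1)$-polytope and $\pi(H_U\cap\mathbb{Z}^n)=\mathbb{Z}^{n-1}$,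 where $H_U$ is the affine span of $U$.
   Formalization: The vertices $v_1,\dots,v_{d+1}$ have rational coordinates, and $T_\sigma$ and the affine spans $H_U$ are taken over ℚ instead of ℝ. -}

module Defs where

open import Data.Nat as ℕ using (ℕ; zero; suc)
open import Data.Nat.Properties as ℕP using (<⇒≤)
open import Data.Integer as ℤ using (ℤ)
open import Data.Rational using (ℚ; 0ℚ; 1ℚ; _+_; _*_; -_; _/_; _÷_; _≟_; ≢-nonZero)
open import Data.Fin using (Fin; zero; suc; toℕ; inject₁; inject≤; punchIn)
open import Data.Fin.Properties using (toℕ<n)
open import Data.Fin.Permutation using (Permutation′; _⟨$⟩ʳ_)
open import Data.Product using (Σ; ∃; _×_)
open import Relation.Binary.PropositionalEquality using (_≡_)
open import Relation.Nullary using (yes; no)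

Point : ℕ → Set
Point n = Fin n → ℚ

sumF : ∀ {n} → (Fin n → ℚ) → ℚ
sumF {zero}  f = 0ℚ
sumF {suc n} f = f zero + sumF (λ i → f (suc i))

ι : ℤ → ℚ
ι z = z / 1

IsInt : ℚ → Set
IsInt q = Σ ℤ λ z → q ≡ ι z

snoc : ∀ {A : Set} {n} → (Fin n → A) → A → Fin (suc n) → A
snoc {n = zero}  f a zero    = a
snoc {n = suc n} f a zero    = f zero
snoc {n = suc n} f a (suc i) = snoc (λ j → f (suc j)) a i

cons : ∀ {A : Set} {n} → A → (Fin n → A) → Fin (suc n) → A
cons a f zero    = a
cons a f (suc i) = f i

π : ∀ {n} → Point (suc n) → Point n
π x i = x (inject₁ i)

AffInd : ∀ {k n} → (Fin k → Point n) → Set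
AffInd {k} {n} p = (λc : Fin k → ℚ) → sumF λc ≡ 0ℚ
  → (∀ c → sumF (λ i → λc i * p i c) ≡ 0ℚ) → ∀ i → λc i ≡ 0ℚ

InAff : ∀ {k n} → (Fin k → Point n) → Point n → Set
InAff {k} {n} p x = Σ (Fin k → ℚ) λ λc → (sumF λc ≡ 1ℚ)
  × (∀ c → sumF (λ i → λc i * p i c) ≡ x c)

-- LatticeFace n v : the (n+1)-simplex with the
-- n+2 vertices v (points of ℚ^{n+1}) is lattice-face.  The n+1-subsets of
-- the vertex set are obtained by removing one vertex j (v ∘ punchIn j).
-- For such a subset U (affinely independent), π(conv U) is an n-polytope
-- iff π(U) is affinely independent, in which case its vertex set is π(U).
LatticeFace : (n : ℕ) → (Fin (suc (suc n)) → Point (suc n)) → Set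
LatticeFace zero    v = AffInd v × (∀ i c → IsInt (v i c))
LatticeFace (suc n) v = AffInd v × (∀ (j : Fin (suc (suc (suc n)))) →
    let U = λ i → v (punchIn j i) in
    LatticeFace n (λ i → π (U i))
    × (∀ (z : Fin (suc n) → ℤ) → Σ ℤ λ t → InAff U (snoc (λ c → ι (z c)) (ι t))))

sgn : ℕ → ℚ → ℚ
sgn zero          q = q
sgn (suc zero)    q = - q
sgn (suc (suc m)) q = sgn m q

det : ∀ {n} → (Fin n → Fin n → ℚ) → ℚ
det {zero}  M = 1ℚ
det {suc n} M = sumF λ j → sgn (toℕ j) (M zero j * det (λ i k → M (suc i) (punchIn j k)))

-- Total division (x / 0 := 0); only used where the denominator is nonzero.
_÷₀_ : ℚ → ℚ → ℚ
p ÷₀ q with q ≟ 0ℚ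
... | yes _ = 0ℚ
... | no q≢0 = _÷_ p q {{≢-nonZero q≢0}}

-- For j : Fin d, k = toℕ j + 1.  Indices 1..k (resp. 1..k-1) embedded in Fin d.
module _ {d : ℕ} (v : Fin (suc d) → Point d) (σ : Permutation′ d) (j : Fin d) where
  private
    emb : Fin (suc (toℕ j)) → Fin d
    emb r = inject≤ r (toℕ<n j)
    emb′ : Fin (toℕ j) → Fin d
    emb′ r = inject≤ r (<⇒≤ (toℕ<n j))
    vert : Fin (suc (toℕ j)) → Point d
    vert r = v (inject₁ (σ ⟨$⟩ʳ emb r))

  Xt : Point d → Fin (suc (suc (toℕ j))) → Fin (suc (suc (toℕ j))) → ℚ
  Xt x = snoc (λ r → cons 1ℚ (λ c → vert r (emb c))) (cons 1ℚ (λ c → x (emb c)))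

  Y : Fin (suc (toℕ j)) → Fin (suc (toℕ j)) → ℚ
  Y r = cons 1ℚ (λ c → vert r (emb′ c))

T : ∀ {d} → (Fin (suc d) → Point d) → Permutation′ d → Point d → Point d
T v σ x j = det (Xt v σ j x) ÷₀ det (Y v σ j)

IsAffine : ∀ {d} → (Point d → Point d) → Set
IsAffine {d} f = Σ (Fin d → Fin d → ℚ) λ A → Σ (Point d) λ b →
  ∀ x i → f x i ≡ sumF (λ k → A i k * x k) + b i

IsInvertible : ∀ {d} → (Point d → Point d) → Set
IsInvertible {d} f = Σ (Point d → Point d) λ g →
  (∀ x i → g (f x) i ≡ x i) × (∀ y i → f (g y) i ≡ y i)

LatticePreserving : ∀ {d} → (Point d → Point d) → Set
LatticePreserving {d} f = IsAffine f × IsInvertible f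
  × (∀ (z : Fin d → ℤ) → ∀ i → IsInt (f (λ c → ι (z c)) i))

{-# OPTIONS --safe #-}
-- Write Pᵣ = v_{σ(r)} and, for a coordinate index j (from 0), Dⱼ(x) = det X̃(σ, j+1; x).
-- Expanding along the last row, Dⱼ is an affine function of x that only sees x₀, …, xⱼ, and
-- moving xⱼ alone changes it by (Δxⱼ) · det Y(σ, j+1). So T_σ is affine and, once every
-- det Y(σ, j+1) is nonzero, unit lower-triangular, hence invertible. Dⱼ vanishes at P₀, …, Pⱼ
-- (two equal rows). The lattice-face property provides, for an integer point z, an affine
-- combination of P₀, …, Pⱼ agreeing with z below j with an integer t in coordinate j; evaluating
-- Dⱼ there gives T_σ(z)ⱼ = zⱼ - t. Finally det Y(σ, j+2) = Dⱼ(P_{j+1}); were it zero, Dⱼ would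
-- vanish at P₀, …, P_{j+1}, hence at every lattice point, forcing det Y(σ, j+1) = 0; as
-- det Y(σ, 1) = 1, no det Y(σ, k) vanishes.
module Submission where

open import Defs
open import Algebra.Bundles using (CommutativeRing)
open import Data.Nat as ℕ using (ℕ; zero; suc)
import Data.Nat.Properties as ℕ
open import Data.Nat.GeneralisedArithmetic using (fold)
open import Data.Integer as ℤ using (ℤ)
import Data.Integer.Properties as ℤ
open import Data.Rational using (ℚ; 0ℚ; 1ℚ; ½; _+_; _*_; -_; _-_; _≟_; ≢-nonZero)
open import Data.Rational.Properties
  using (+-*-commutativeRing; +-0-group; +-identityˡ; +-identityʳ; *-identityˡ; *-identityʳ;
         *-zeroˡ; *-zeroʳ; neg-distrib-+; neg-distribʳ-*; *-inverseʳ;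
         toℚᵘ-injective; toℚᵘ-homo-+; toℚᵘ-homo‿-; toℚᵘ-fromℚᵘ)
open import Data.Rational.Unnormalised as ℚᵘ using (mkℚᵘ; *≡*)
import Data.Rational.Unnormalised.Properties as ℚᵘ
open import Data.Rational.Solver using (module +-*-Solver)
open import Data.Fin using (Fin; zero; suc; toℕ; inject₁; inject≤; fromℕ; fromℕ<; punchIn; _<_; _≤_)
open import Data.Fin.Properties
  using (toℕ-injective; toℕ-inject₁; toℕ-inject≤; toℕ-fromℕ; toℕ-fromℕ<; toℕ<n; ≤fromℕ;
         fromℕ≢inject₁; punchInᵢ≢i)
open import Data.Fin.Relation.Unary.Top using (view; ‵fromℕ; ‵inject₁)
open import Data.Fin.Induction using (<-weakInduction)
open import Data.Fin.Permutation using (Permutation′; _⟨$⟩ʳ_; _⟨$⟩ˡ_; inverseʳ; remove; punchIn-permute)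
open import Data.Product using (Σ; _×_; _,_; proj₁; proj₂)
open import Data.Sum using (inj₁; inj₂)
open import Function using (_∘_)
open import Relation.Binary.PropositionalEquality
open import Relation.Nullary using (contradiction; yes; no)
open import Algebra.Properties.Group +-0-group using (∙-cancelˡ)
open import Algebra.Properties.Semiring.Sum (CommutativeRing.semiring +-*-commutativeRing)
  using (sum; sum-cong-≗; sum-replicate-zero; ∑-distrib-+; ∑-comm; sum-init-last; sum-remove;
         *-distribˡ-sum)

open +-*-Solver
open ≡-Reasoning

sumF≡sum : ∀ {n} (f : Fin n → ℚ) → sumF f ≡ sum f
sumF≡sum {zero}  f = refl
sumF≡sum {suc n} f = cong (f zero +_) (sumF≡sum (λ i → f (suc i)))

sumF-cong : ∀ {n} {f g : Fin n → ℚ} → (∀ i → f i ≡ g i) → sumF f ≡ sumF g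
sumF-cong {f = f} {g} f≗g = begin
  sumF f ≡⟨ sumF≡sum f ⟩
  sum f  ≡⟨ sum-cong-≗ f≗g ⟩
  sum g  ≡⟨ sumF≡sum g ⟨
  sumF g ∎

sumF-zero : ∀ n → sumF {n} (λ _ → 0ℚ) ≡ 0ℚ
sumF-zero n = trans (sumF≡sum {n} (λ _ → 0ℚ)) (sum-replicate-zero n)

sumF-distrib-+ : ∀ {n} (f g : Fin n → ℚ) → sumF (λ i → f i + g i) ≡ sumF f + sumF g
sumF-distrib-+ f g = begin
  sumF (λ i → f i + g i) ≡⟨ sumF≡sum (λ i → f i + g i) ⟩
  sum (λ i → f i + g i)  ≡⟨ ∑-distrib-+ f g ⟩
  sum f + sum g          ≡⟨ cong₂ _+_ (sumF≡sum f) (sumF≡sum g) ⟨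
  sumF f + sumF g        ∎

*-distribˡ-sumF : ∀ {n} (c : ℚ) (f : Fin n → ℚ) → c * sumF f ≡ sumF (λ i → c * f i)
*-distribˡ-sumF c f = begin
  c * sumF f           ≡⟨ cong (c *_) (sumF≡sum f) ⟩
  c * sum f            ≡⟨ *-distribˡ-sum c f ⟩
  sum (λ i → c * f i)  ≡⟨ sumF≡sum (λ i → c * f i) ⟨
  sumF (λ i → c * f i) ∎

sumF-comm : ∀ {m n} (F : Fin m → Fin n → ℚ) →
  sumF (λ i → sumF (λ j → F i j)) ≡ sumF (λ j → sumF (λ i → F i j))
sumF-comm F = begin
  sumF (λ i → sumF (λ j → F i j)) ≡⟨ sumF-cong (λ i → sumF≡sum (F i)) ⟩
  sumF (λ i → sum (λ j → F i j))  ≡⟨ sumF≡sum (λ i → sum (λ j → F i j)) ⟩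
  sum (λ i → sum (λ j → F i j))   ≡⟨ ∑-comm F ⟩
  sum (λ j → sum (λ i → F i j))   ≡⟨ sumF≡sum (λ j → sum (λ i → F i j)) ⟨
  sumF (λ j → sum (λ i → F i j))  ≡⟨ sumF-cong (λ j → sumF≡sum (λ i → F i j)) ⟨
  sumF (λ j → sumF (λ i → F i j)) ∎

sumF-init-last : ∀ {n} (f : Fin (suc n) → ℚ) → sumF f ≡ sumF (λ i → f (inject₁ i)) + f (fromℕ n)
sumF-init-last f = begin
  sumF f                                   ≡⟨ sumF≡sum f ⟩
  sum f                                    ≡⟨ sum-init-last f ⟩
  sum (λ i → f (inject₁ i)) + f (fromℕ _)  ≡⟨ cong (_+ f (fromℕ _)) (sumF≡sum (λ i → f (inject₁ i))) ⟨
  sumF (λ i → f (inject₁ i)) + f (fromℕ _) ∎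

sumF-remove : ∀ {n} (f : Fin (suc n) → ℚ) (i : Fin (suc n)) →
  sumF f ≡ f i + sumF (λ l → f (punchIn i l))
sumF-remove f i = begin
  sumF f                             ≡⟨ sumF≡sum f ⟩
  sum f                              ≡⟨ sum-remove f ⟩
  f i + sum (λ l → f (punchIn i l))  ≡⟨ cong (f i +_) (sumF≡sum (λ l → f (punchIn i l))) ⟨
  f i + sumF (λ l → f (punchIn i l)) ∎

sumF-neg : ∀ {n} (f : Fin n → ℚ) → sumF (λ i → - f i) ≡ - sumF f
sumF-neg {zero}  f = refl
sumF-neg {suc n} f =
  trans (cong (- f zero +_) (sumF-neg (λ i → f (suc i)))) (sym (neg-distrib-+ (f zero) _))

sumF-diag+offDiag : ∀ {n} (F : Fin (suc n) → Fin (suc n) → ℚ) →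
  sumF (λ j → F j j) + sumF (λ j → sumF (λ l → F j (punchIn j l))) ≡ sumF (λ j → sumF (λ k → F j k))
sumF-diag+offDiag F = begin
  sumF (λ j → F j j) + sumF (λ j → sumF (λ l → F j (punchIn j l)))
    ≡⟨ sumF-distrib-+ (λ j → F j j) (λ j → sumF (λ l → F j (punchIn j l))) ⟨
  sumF (λ j → F j j + sumF (λ l → F j (punchIn j l)))
    ≡⟨ sumF-cong (λ j → sumF-remove (F j) j) ⟨
  sumF (λ j → sumF (λ k → F j k)) ∎

sumF-offDiag-transpose : ∀ {n} (F : Fin (suc n) → Fin (suc n) → ℚ) →
  sumF (λ j → sumF (λ l → F j (punchIn j l))) ≡ sumF (λ j → sumF (λ l → F (punchIn j l) j))
sumF-offDiag-transpose F = ∙-cancelˡ (sumF (λ j → F j j)) _ _ (begin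
  sumF (λ j → F j j) + sumF (λ j → sumF (λ l → F j (punchIn j l))) ≡⟨ sumF-diag+offDiag F ⟩
  sumF (λ j → sumF (λ k → F j k))                                  ≡⟨ sumF-comm F ⟩
  sumF (λ k → sumF (λ j → F j k))                                  ≡⟨ sumF-diag+offDiag (λ k j → F j k) ⟨
  sumF (λ j → F j j) + sumF (λ j → sumF (λ l → F (punchIn j l) j)) ∎)

snoc-inject₁ : ∀ {A : Set} {n} (f : Fin n → A) (a : A) (i : Fin n) → snoc f a (inject₁ i) ≡ f i
snoc-inject₁ {n = suc n} f a zero    = refl
snoc-inject₁ {n = suc n} f a (suc i) = snoc-inject₁ (λ j → f (suc j)) a i

snoc-last : ∀ {A : Set} {n} (f : Fin n → A) (a : A) → snoc f a (fromℕ n) ≡ a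
snoc-last {n = zero}  f a = refl
snoc-last {n = suc n} f a = snoc-last (λ j → f (suc j)) a

snoc-map : ∀ {A B : Set} {n} (h : A → B) (f : Fin n → A) (a : A) (i : Fin (suc n)) →
  h (snoc f a i) ≡ snoc (λ r → h (f r)) (h a) i
snoc-map {n = zero}  h f a zero    = refl
snoc-map {n = suc n} h f a zero    = refl
snoc-map {n = suc n} h f a (suc i) = snoc-map h (λ j → f (suc j)) a i

snoc-congʳ : ∀ {A B : Set} {n} (f : Fin n → A → B) {a a′ : A → B} →
  (∀ x → a x ≡ a′ x) → ∀ i x → snoc f a i x ≡ snoc f a′ i x
snoc-congʳ {n = zero}  f a≗a′ zero    x = a≗a′ x
snoc-congʳ {n = suc n} f a≗a′ zero    x = refl
snoc-congʳ {n = suc n} f a≗a′ (suc i) x = snoc-congʳ (λ j → f (suc j)) a≗a′ i x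

swap₀₁ : ∀ {A : Set} {n} → (Fin (suc (suc n)) → A) → Fin (suc (suc n)) → A
swap₀₁ f zero          = f (suc zero)
swap₀₁ f (suc zero)    = f zero
swap₀₁ f (suc (suc i)) = f (suc (suc i))

swap₀₁-involutive : ∀ {A : Set} {n} (f : Fin (suc (suc n)) → A) i → swap₀₁ (swap₀₁ f) i ≡ f i
swap₀₁-involutive f zero          = refl
swap₀₁-involutive f (suc zero)    = refl
swap₀₁-involutive f (suc (suc i)) = refl

punchIn-fromℕ : ∀ {n} (i : Fin n) → punchIn (fromℕ n) i ≡ inject₁ i
punchIn-fromℕ zero    = refl
punchIn-fromℕ (suc i) = cong suc (punchIn-fromℕ i)

punchIn-inject₁ : ∀ {n} (j : Fin (suc n)) (k : Fin n) →
  punchIn (inject₁ j) (inject₁ k) ≡ inject₁ (punchIn j k)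
punchIn-inject₁ zero    k       = refl
punchIn-inject₁ (suc j) zero    = refl
punchIn-inject₁ (suc j) (suc k) = cong suc (punchIn-inject₁ j k)

-- A total punchOut: punchOut′ i j = punchOut {i = i} {j = j} _ whenever i ≢ j (junk when i ≡ j).
punchOut′ : ∀ {n} → Fin (suc (suc n)) → Fin (suc (suc n)) → Fin (suc n)
punchOut′         zero    zero    = zero
punchOut′         zero    (suc j) = j
punchOut′         (suc i) zero    = zero
punchOut′ {zero}  (suc i) (suc j) = zero
punchOut′ {suc n} (suc i) (suc j) = suc (punchOut′ i j)

punchOut′-punchIn : ∀ {n} (i : Fin (suc (suc n))) (l : Fin (suc n)) → punchOut′ i (punchIn i l) ≡ l
punchOut′-punchIn         zero    l       = refl
punchOut′-punchIn         (suc i) zero    = refl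
punchOut′-punchIn {suc n} (suc i) (suc l) = cong suc (punchOut′-punchIn i l)

punchIn-punchOut′ : ∀ {n} {i j : Fin (suc (suc n))} → i ≢ j → punchIn i (punchOut′ i j) ≡ j
punchIn-punchOut′ {i = zero}  {zero}  i≢j = contradiction refl i≢j
punchIn-punchOut′ {i = zero}  {suc j} i≢j = refl
punchIn-punchOut′ {i = suc i} {zero}  i≢j = refl
punchIn-punchOut′ {zero}  {suc zero} {suc zero} i≢j = contradiction refl i≢j
punchIn-punchOut′ {suc n} {suc i}    {suc j}    i≢j = cong suc (punchIn-punchOut′ (i≢j ∘ cong suc))

punchIn-punchIn-flip : ∀ {n} (i : Fin (suc (suc n))) (l : Fin (suc n)) (k : Fin n) →
  punchIn (punchIn i l) (punchIn (punchOut′ (punchIn i l) i) k) ≡ punchIn i (punchIn l k)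
punchIn-punchIn-flip         zero    l       k       = refl
punchIn-punchIn-flip         (suc i) zero    k       = refl
punchIn-punchIn-flip {suc n} (suc i) (suc l) zero    = refl
punchIn-punchIn-flip {suc n} (suc i) (suc l) (suc k) = cong suc (punchIn-punchIn-flip i l k)

sgn-suc : ∀ n q → sgn (suc n) q ≡ - sgn n q
sgn-suc zero          q = refl
sgn-suc (suc zero)    q = solve 1 (λ q → q := :- (:- q)) refl q
sgn-suc (suc (suc n)) q = sgn-suc n q

sgn-zero : ∀ n → sgn n 0ℚ ≡ 0ℚ
sgn-zero zero          = refl
sgn-zero (suc zero)    = refl
sgn-zero (suc (suc n)) = sgn-zero n

sgn-neg : ∀ n q → sgn n (- q) ≡ - sgn n q
sgn-neg zero          q = refl
sgn-neg (suc zero)    q = refl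
sgn-neg (suc (suc n)) q = sgn-neg n q

sgn-*ˡ : ∀ n c q → sgn n (c * q) ≡ c * sgn n q
sgn-*ˡ zero          c q = refl
sgn-*ˡ (suc zero)    c q = neg-distribʳ-* c q
sgn-*ˡ (suc (suc n)) c q = sgn-*ˡ n c q

sgn-distrib-+ : ∀ n p q → sgn n (p + q) ≡ sgn n p + sgn n q
sgn-distrib-+ zero          p q = refl
sgn-distrib-+ (suc zero)    p q = neg-distrib-+ p q
sgn-distrib-+ (suc (suc n)) p q = sgn-distrib-+ n p q

sgn-sumF : ∀ n {k} (f : Fin k → ℚ) → sgn n (sumF f) ≡ sumF (λ i → sgn n (f i))
sgn-sumF n {zero}  f = sgn-zero n
sgn-sumF n {suc k} f =
  trans (sgn-distrib-+ n (f zero) _) (cong (sgn n (f zero) +_) (sgn-sumF n (λ i → f (suc i))))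

sgn-*-zero : ∀ n c {q} → q ≡ 0ℚ → sgn n (c * q) ≡ 0ℚ
sgn-*-zero n c refl = trans (cong (sgn n) (*-zeroʳ c)) (sgn-zero n)

-- The pairs (i, l) and (punchIn i l, punchOut′ (punchIn i l) i) have index sums of opposite parity.
sgn-flip : ∀ {n} (i : Fin (suc (suc n))) (l : Fin (suc n)) q →
  sgn (toℕ i) (sgn (toℕ l) q) ≡ - sgn (toℕ (punchIn i l)) (sgn (toℕ (punchOut′ (punchIn i l) i)) q)
sgn-flip zero    l    q = sym (trans (cong -_ (sgn-suc (toℕ l) q)) (solve 1 (λ q → :- (:- q) := q) refl _))
sgn-flip (suc i) zero q = sgn-suc (toℕ i) q
sgn-flip {suc n} (suc i) (suc l) q = begin
  sgn (suc (toℕ i)) (sgn (suc (toℕ l)) q)    ≡⟨ sgn-suc (toℕ i) _ ⟩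
  - sgn (toℕ i) (sgn (suc (toℕ l)) q)        ≡⟨ cong (λ p → - sgn (toℕ i) p) (sgn-suc (toℕ l) q) ⟩
  - sgn (toℕ i) (- sgn (toℕ l) q)            ≡⟨ cong -_ (sgn-neg (toℕ i) _) ⟩
  - - sgn (toℕ i) (sgn (toℕ l) q)            ≡⟨ cong (λ p → - - p) (sgn-flip i l q) ⟩
  - - - sgn (toℕ b) (sgn (toℕ l′) q)         ≡⟨ cong (λ p → - - p) (sgn-neg (toℕ b) _) ⟨
  - - sgn (toℕ b) (- sgn (toℕ l′) q)         ≡⟨ cong (λ p → - - sgn (toℕ b) p) (sgn-suc (toℕ l′) q) ⟨
  - - sgn (toℕ b) (sgn (suc (toℕ l′)) q)     ≡⟨ cong -_ (sgn-suc (toℕ b) _) ⟨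
  - sgn (suc (toℕ b)) (sgn (suc (toℕ l′)) q) ∎
  where
  b : Fin (suc (suc n))
  b = punchIn i l
  l′ : Fin (suc n)
  l′ = punchOut′ (punchIn i l) i

δ : ∀ {n} → Fin n → Fin n → ℤ
δ zero    zero    = ℤ.+ 1
δ zero    (suc _) = ℤ.+ 0
δ (suc _) zero    = ℤ.+ 0
δ (suc i) (suc j) = δ i j

basis : ∀ {n} → Fin n → Point n
basis i c = ι (δ i c)

δ-diag : ∀ {n} (i : Fin n) → δ i i ≡ ℤ.+ 1
δ-diag zero    = refl
δ-diag (suc i) = δ-diag i

δ-off-diag : ∀ {n} {i j : Fin n} → i ≢ j → δ i j ≡ ℤ.+ 0
δ-off-diag {i = zero}  {zero}  i≢j = contradiction refl i≢j
δ-off-diag {i = zero}  {suc j} i≢j = refl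
δ-off-diag {i = suc i} {zero}  i≢j = refl
δ-off-diag {i = suc i} {suc j} i≢j = δ-off-diag (i≢j ∘ cong suc)

δ-fromℕ-punchIn-inject₁ : ∀ {n} (j k : Fin (suc n)) →
  δ (fromℕ (suc n)) (punchIn (inject₁ j) k) ≡ δ (fromℕ n) k
δ-fromℕ-punchIn-inject₁         zero    k       = refl
δ-fromℕ-punchIn-inject₁ {suc n} (suc j) zero    = refl
δ-fromℕ-punchIn-inject₁ {suc n} (suc j) (suc k) = δ-fromℕ-punchIn-inject₁ j k

sumF-basis : ∀ {n} (x : Point n) (p : Fin n) → sumF (λ c → x c * basis c p) ≡ x p
sumF-basis {suc n} x zero = begin
  x zero * 1ℚ + sumF (λ c → x (suc c) * 0ℚ)
    ≡⟨ cong (x zero * 1ℚ +_) (trans (sumF-cong (λ c → *-zeroʳ (x (suc c)))) (sumF-zero n)) ⟩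
  x zero * 1ℚ + 0ℚ
    ≡⟨ solve 1 (λ a → a :* con 1ℚ :+ con 0ℚ := a) refl (x zero) ⟩
  x zero ∎
sumF-basis x (suc p) = begin
  x zero * 0ℚ + sumF (λ c → x (suc c) * basis c p)
    ≡⟨ cong (x zero * 0ℚ +_) (sumF-basis (λ c → x (suc c)) p) ⟩
  x zero * 0ℚ + x (suc p)
    ≡⟨ solve 2 (λ a b → a :* con 0ℚ :+ b := b) refl (x zero) (x (suc p)) ⟩
  x (suc p) ∎

-- Determinants

Matrix : ℕ → Set
Matrix n = Fin n → Fin n → ℚ

minor : ∀ {m n} → (Fin (suc m) → Fin (suc n) → ℚ) → Fin (suc n) → Fin m → Fin n → ℚ
minor M j i k = M (suc i) (punchIn j k)

det-cong : ∀ {n} {M N : Matrix n} → (∀ i k → M i k ≡ N i k) → det M ≡ det N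
det-cong {zero}  M≗N = refl
det-cong {suc n} M≗N = sumF-cong (λ j → cong (sgn (toℕ j))
  (cong₂ _*_ (M≗N zero j) (det-cong (λ i k → M≗N (suc i) (punchIn j k)))))

det-cong-toℕ : ∀ {m n} (M : Matrix m) (N : Matrix n) → m ≡ n →
  (∀ i k i′ k′ → toℕ i ≡ toℕ i′ → toℕ k ≡ toℕ k′ → M i k ≡ N i′ k′) → det M ≡ det N
det-cong-toℕ M N refl M≈N = det-cong (λ i k → M≈N i k i k refl refl)

det₁ : (M : Matrix 1) → det M ≡ M zero zero
det₁ M = solve 1 (λ a → a :* con 1ℚ :+ con 0ℚ := a) refl (M zero zero)

det-minor-snoc : ∀ {n} (R : Fin (suc n) → Fin (suc (suc n)) → ℚ) (a : Fin (suc (suc n)) → ℚ) j →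
  det (minor (snoc R a) j) ≡ det (snoc (minor R j) (λ k → a (punchIn j k)))
det-minor-snoc R a j = det-cong (λ i k →
  cong (λ row → row k) (snoc-map (λ row k → row (punchIn j k)) (λ r → R (suc r)) a i))

det-snoc-linear : ∀ {n K} (R : Fin n → Fin (suc n) → ℚ) (a : Fin (suc n) → ℚ)
  (κ : Fin K → ℚ) (b : Fin K → Fin (suc n) → ℚ) → (∀ c → a c ≡ sumF (λ l → κ l * b l c)) →
  det (snoc R a) ≡ sumF (λ l → κ l * det (snoc R (b l)))
det-snoc-linear {zero} R a κ b a≡κb = begin
  det (snoc R a)                        ≡⟨ det₁ (snoc R a) ⟩
  a zero                                ≡⟨ a≡κb zero ⟩
  sumF (λ l → κ l * b l zero)           ≡⟨ sumF-cong (λ l → cong (κ l *_) (det₁ (snoc R (b l)))) ⟨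
  sumF (λ l → κ l * det (snoc R (b l))) ∎
det-snoc-linear {suc n} {K} R a κ b a≡κb = begin
  sumF (λ j → term j (det (minor (snoc R a) j)))
    ≡⟨ sumF-cong (λ j → cong (term j) (trans (det-minor-snoc R a j)
         (det-snoc-linear (minor R j) _ κ (λ l k → b l (punchIn j k)) (λ k → a≡κb (punchIn j k))))) ⟩
  sumF (λ j → term j (sumF (λ l → κ l * D j l)))
    ≡⟨ sumF-cong (λ j → term-linear j (D j)) ⟩
  sumF (λ j → sumF (λ l → κ l * term j (D j l)))
    ≡⟨ sumF-comm (λ j l → κ l * term j (D j l)) ⟩
  sumF (λ l → sumF (λ j → κ l * term j (D j l)))
    ≡⟨ sumF-cong (λ l → *-distribˡ-sumF (κ l) (λ j → term j (D j l))) ⟨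
  sumF (λ l → κ l * sumF (λ j → term j (D j l)))
    ≡⟨ sumF-cong (λ l → cong (κ l *_) (sumF-cong (λ j → cong (term j) (det-minor-snoc R (b l) j)))) ⟨
  sumF (λ l → κ l * det (snoc R (b l))) ∎
  where
  term : Fin (suc (suc n)) → ℚ → ℚ
  term j q = sgn (toℕ j) (R zero j * q)
  D : Fin (suc (suc n)) → Fin K → ℚ
  D j l = det (snoc (minor R j) (λ k → b l (punchIn j k)))
  term-linear : ∀ j (q : Fin K → ℚ) → term j (sumF (λ l → κ l * q l)) ≡ sumF (λ l → κ l * term j (q l))
  term-linear j q = begin
    sgn (toℕ j) (R zero j * sumF (λ l → κ l * q l))
      ≡⟨ cong (sgn (toℕ j)) (*-distribˡ-sumF (R zero j) (λ l → κ l * q l)) ⟩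
    sgn (toℕ j) (sumF (λ l → R zero j * (κ l * q l)))
      ≡⟨ sgn-sumF (toℕ j) (λ l → R zero j * (κ l * q l)) ⟩
    sumF (λ l → sgn (toℕ j) (R zero j * (κ l * q l)))
      ≡⟨ sumF-cong (λ l → trans (cong (sgn (toℕ j)) (swap-factors (R zero j) (κ l) (q l)))
                                (sgn-*ˡ (toℕ j) (κ l) _)) ⟩
    sumF (λ l → κ l * sgn (toℕ j) (R zero j * q l)) ∎
    where
    swap-factors : ∀ r k q → r * (k * q) ≡ k * (r * q)
    swap-factors = solve 3 (λ r k q → r :* (k :* q) := k :* (r :* q)) refl

det-snoc-zero : ∀ {n} (R : Fin n → Fin (suc n) → ℚ) (a : Fin (suc n) → ℚ) →
  (∀ c → a c ≡ 0ℚ) → det (snoc R a) ≡ 0ℚ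
det-snoc-zero R a a≡0 = det-snoc-linear {K = 0} R a (λ ()) (λ ()) a≡0

det-snoc-cong : ∀ {n} (R : Fin n → Fin (suc n) → ℚ) {a a′ : Fin (suc n) → ℚ} →
  (∀ c → a c ≡ a′ c) → det (snoc R a) ≡ det (snoc R a′)
det-snoc-cong R a≗a′ = det-cong (snoc-congʳ R a≗a′)

det-snoc-+* : ∀ {n} (R : Fin n → Fin (suc n) → ℚ) {a a₀ a₁ : Fin (suc n) → ℚ} (s : ℚ) →
  (∀ c → a c ≡ a₀ c + s * a₁ c) → det (snoc R a) ≡ det (snoc R a₀) + s * det (snoc R a₁)
det-snoc-+* R {a} {a₀} {a₁} s a≡ = begin
  det (snoc R a)
    ≡⟨ det-snoc-linear R a κ b (λ c → trans (a≡ c) (as-sum (a₀ c) (a₁ c))) ⟩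
  1ℚ * det (snoc R a₀) + (s * det (snoc R a₁) + 0ℚ)
    ≡⟨ as-sum (det (snoc R a₀)) (det (snoc R a₁)) ⟨
  det (snoc R a₀) + s * det (snoc R a₁) ∎
  where
  κ : Fin 2 → ℚ
  κ zero       = 1ℚ
  κ (suc zero) = s
  b : Fin 2 → Fin (suc _) → ℚ
  b zero       = a₀
  b (suc zero) = a₁
  as-sum : ∀ p q → p + s * q ≡ 1ℚ * p + (s * q + 0ℚ)
  as-sum p q = solve 3 (λ p s q → p :+ s :* q := con 1ℚ :* p :+ (s :* q :+ con 0ℚ)) refl p s q

det-snoc-basis-fromℕ : ∀ {n} (R : Fin n → Fin (suc n) → ℚ) →
  det (snoc R (basis (fromℕ n))) ≡ det (λ i k → R i (inject₁ k))
det-snoc-basis-fromℕ {zero}  R = refl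
det-snoc-basis-fromℕ {suc n} R = begin
  sumF term                                                             ≡⟨ sumF-init-last term ⟩
  sumF (λ j → term (inject₁ j)) + term (fromℕ (suc n))                  ≡⟨ cong₂ _+_ (sumF-cong inner) last ⟩
  sumF (λ j → sgn (toℕ j) (R zero (inject₁ j) * det (minor R′ j))) + 0ℚ ≡⟨ +-identityʳ _ ⟩
  det R′                                                                ∎
  where
  e : Fin (suc (suc n)) → ℚ
  e = basis (fromℕ (suc n))
  R′ : Matrix (suc n)
  R′ i k = R i (inject₁ k)
  term : Fin (suc (suc n)) → ℚ
  term j = sgn (toℕ j) (R zero j * det (minor (snoc R e) j))
  inner : ∀ j → term (inject₁ j) ≡ sgn (toℕ j) (R zero (inject₁ j) * det (minor R′ j))
  inner j = cong₂ sgn (toℕ-inject₁ j) (cong (R zero (inject₁ j) *_) (begin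
    det (minor (snoc R e) (inject₁ j))
      ≡⟨ det-minor-snoc R e (inject₁ j) ⟩
    det (snoc (minor R (inject₁ j)) (λ k → e (punchIn (inject₁ j) k)))
      ≡⟨ det-snoc-cong (minor R (inject₁ j)) (λ k → cong ι (δ-fromℕ-punchIn-inject₁ j k)) ⟩
    det (snoc (minor R (inject₁ j)) (basis (fromℕ n)))
      ≡⟨ det-snoc-basis-fromℕ (minor R (inject₁ j)) ⟩
    det (λ i k → R (suc i) (punchIn (inject₁ j) (inject₁ k)))
      ≡⟨ det-cong (λ i k → cong (R (suc i)) (punchIn-inject₁ j k)) ⟩
    det (minor R′ j) ∎))
  last : term (fromℕ (suc n)) ≡ 0ℚ
  last = sgn-*-zero (toℕ (fromℕ (suc n))) (R zero (fromℕ (suc n))) (trans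
    (det-minor-snoc R e (fromℕ (suc n)))
    (det-snoc-zero (minor R (fromℕ (suc n))) _ (λ k →
      cong ι (δ-off-diag (punchInᵢ≢i (fromℕ (suc n)) k ∘ sym)))))

term₂ : ∀ {n} → Matrix (suc (suc n)) → Fin (suc (suc n)) → Fin (suc n) → ℚ
term₂ M j l = sgn (toℕ j) (sgn (toℕ l) (M zero j * (M (suc zero) (punchIn j l) * det (minor (minor M j) l))))

det-expand₂ : ∀ {n} (M : Matrix (suc (suc n))) → det M ≡ sumF (λ j → sumF (λ l → term₂ M j l))
det-expand₂ M = sumF-cong (λ j → begin
  sgn (toℕ j) (M zero j * sumF (λ l → sgn (toℕ l) (X j l)))
    ≡⟨ cong (sgn (toℕ j)) (*-distribˡ-sumF (M zero j) (λ l → sgn (toℕ l) (X j l))) ⟩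
  sgn (toℕ j) (sumF (λ l → M zero j * sgn (toℕ l) (X j l)))
    ≡⟨ sgn-sumF (toℕ j) (λ l → M zero j * sgn (toℕ l) (X j l)) ⟩
  sumF (λ l → sgn (toℕ j) (M zero j * sgn (toℕ l) (X j l)))
    ≡⟨ sumF-cong (λ l → cong (sgn (toℕ j)) (sgn-*ˡ (toℕ l) (M zero j) (X j l))) ⟨
  sumF (λ l → term₂ M j l) ∎)
  where
  X : Fin _ → Fin _ → ℚ
  X j l = M (suc zero) (punchIn j l) * det (minor (minor M j) l)

-- In the expansion along the first two rows, the term of swap₀₁ M for the pair (j, l) is minus
-- the term of M for the pair (punchIn j l, punchOut′ (punchIn j l) j).
det-swap₀₁ : ∀ {n} (M : Matrix (suc (suc n))) → det (swap₀₁ M) ≡ - det M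
det-swap₀₁ M = begin
  det (swap₀₁ M)                                 ≡⟨ det-expand₂ (swap₀₁ M) ⟩
  sumF (λ j → sumF (λ l → term₂ (swap₀₁ M) j l)) ≡⟨ sumF-cong (λ j → sumF-cong (λ l → flipped j l)) ⟩
  sumF (λ j → sumF (λ l → - G (punchIn j l) j))  ≡⟨ sumF-cong (λ j → sumF-neg (λ l → G (punchIn j l) j)) ⟩
  sumF (λ j → - sumF (λ l → G (punchIn j l) j))  ≡⟨ sumF-neg (λ j → sumF (λ l → G (punchIn j l) j)) ⟩
  - sumF (λ j → sumF (λ l → G (punchIn j l) j))  ≡⟨ cong -_ (sumF-offDiag-transpose G) ⟨
  - sumF (λ j → sumF (λ l → G j (punchIn j l)))  ≡⟨ cong -_ (sumF-cong (λ j → sumF-cong (λ l →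
                                                      cong (term₂ M j) (punchOut′-punchIn j l)))) ⟩
  - sumF (λ j → sumF (λ l → term₂ M j l))        ≡⟨ cong -_ (det-expand₂ M) ⟨
  - det M                                        ∎
  where
  G : Fin _ → Fin _ → ℚ
  G i j = term₂ M i (punchOut′ i j)
  flipped : ∀ j l → term₂ (swap₀₁ M) j l ≡ - G (punchIn j l) j
  flipped j l = begin
    sgn (toℕ j) (sgn (toℕ l) (M (suc zero) j * (M zero i * D)))
      ≡⟨ sgn-flip j l _ ⟩
    - sgn (toℕ i) (sgn (toℕ l′) (M (suc zero) j * (M zero i * D)))
      ≡⟨ cong (λ q → - sgn (toℕ i) (sgn (toℕ l′) q))
              (solve 3 (λ x y z → x :* (y :* z) := y :* (x :* z)) refl (M (suc zero) j) (M zero i) D) ⟩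
    - sgn (toℕ i) (sgn (toℕ l′) (M zero i * (M (suc zero) j * D)))
      ≡⟨ cong (λ q → - sgn (toℕ i) (sgn (toℕ l′) (M zero i * q)))
              (cong₂ _*_ (cong (M (suc zero)) i↦j) D≡D′) ⟨
    - G i j ∎
    where
    i : Fin _
    i = punchIn j l
    l′ : Fin _
    l′ = punchOut′ i j
    D : ℚ
    D = det (minor (minor M j) l)
    i↦j : punchIn i l′ ≡ j
    i↦j = punchIn-punchOut′ (punchInᵢ≢i j l)
    D≡D′ : det (minor (minor M i) l′) ≡ D
    D≡D′ = det-cong (λ r k → cong (M (suc (suc r))) (punchIn-punchIn-flip j l k))

self-neg⇒zero : ∀ q → q ≡ - q → q ≡ 0ℚ
self-neg⇒zero q q≡-q = begin
  q             ≡⟨ solve 1 (λ q → q := (q :+ q) :* con ½) refl q ⟩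
  (q + q) * ½   ≡⟨ cong (λ p → (q + p) * ½) q≡-q ⟩
  (q + - q) * ½ ≡⟨ solve 1 (λ q → (q :+ :- q) :* con ½ := con 0ℚ) refl q ⟩
  0ℚ            ∎

det-equal-rows : ∀ {n} (M : Matrix n) {i i′ : Fin n} → i ≢ i′ → (∀ c → M i c ≡ M i′ c) → det M ≡ 0ℚ
det-equal-rows-below : ∀ {n} (M : Matrix (suc (suc n))) {a b : Fin (suc n)} → a ≢ b →
  (∀ c → M (suc a) c ≡ M (suc b) c) → det M ≡ 0ℚ
det-equal-row₀ : ∀ {n} (M : Matrix (suc (suc n))) (b : Fin (suc n)) →
  (∀ c → M zero c ≡ M (suc b) c) → det M ≡ 0ℚ

det-equal-rows {suc zero}    M {zero}  {zero}  i≢i′ _  = contradiction refl i≢i′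
det-equal-rows {suc (suc n)} M {zero}  {zero}  i≢i′ _  = contradiction refl i≢i′
det-equal-rows {suc (suc n)} M {zero}  {suc b} _    eq = det-equal-row₀ M b eq
det-equal-rows {suc (suc n)} M {suc a} {zero}  _    eq = det-equal-row₀ M a (sym ∘ eq)
det-equal-rows {suc (suc n)} M {suc a} {suc b} a≢b  eq = det-equal-rows-below M (a≢b ∘ cong suc) eq

det-equal-rows-below {n} M a≢b eq = trans (sumF-cong vanish) (sumF-zero (suc (suc n)))
  where
  vanish : ∀ j → sgn (toℕ j) (M zero j * det (minor M j)) ≡ 0ℚ
  vanish j = sgn-*-zero (toℕ j) (M zero j) (det-equal-rows (minor M j) a≢b (λ k → eq (punchIn j k)))

det-equal-row₀ M zero eq = self-neg⇒zero (det M) (trans (det-cong rows₀₁) (det-swap₀₁ M))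
  where
  rows₀₁ : ∀ i k → M i k ≡ swap₀₁ M i k
  rows₀₁ zero          k = eq k
  rows₀₁ (suc zero)    k = sym (eq k)
  rows₀₁ (suc (suc i)) k = refl
det-equal-row₀ M (suc b) eq = begin
  det M                   ≡⟨ det-cong (λ i k → cong (λ row → row k) (swap₀₁-involutive M i)) ⟨
  det (swap₀₁ (swap₀₁ M)) ≡⟨ det-swap₀₁ (swap₀₁ M) ⟩
  - det (swap₀₁ M)        ≡⟨ cong -_ (det-equal-rows-below (swap₀₁ M) {zero} {suc b} (λ ()) eq) ⟩
  0ℚ                      ∎

det-snoc-row : ∀ {n} (R : Fin n → Fin (suc n) → ℚ) (r : Fin n) → det (snoc R (R r)) ≡ 0ℚ
det-snoc-row R r = det-equal-rows (snoc R (R r)) (fromℕ≢inject₁ ∘ sym) (λ c → trans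
  (cong (λ row → row c) (snoc-inject₁ R (R r) r)) (sym (cong (λ row → row c) (snoc-last R (R r)))))

-- Affine and unit triangular maps

AffineFunctional : ∀ {n} → (Point n → ℚ) → Set
AffineFunctional {n} F = Σ (Point n) λ a → Σ ℚ λ b → ∀ x → F x ≡ sumF (λ k → a k * x k) + b

affine-rows : ∀ {n} {f : Point n → Point n} → (∀ i → AffineFunctional (λ x → f x i)) → IsAffine f
affine-rows rowᵢ =
  (λ i → proj₁ (rowᵢ i)) , (λ i → proj₁ (proj₂ (rowᵢ i))) , λ x i → proj₂ (proj₂ (rowᵢ i)) x

affine-combination : ∀ {n K} {F : Point n → ℚ} → AffineFunctional F →
  (κ : Fin K → ℚ) (p : Fin K → Point n) → sumF κ ≡ 1ℚ →
  F (λ c → sumF (λ i → κ i * p i c)) ≡ sumF (λ i → κ i * F (p i))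
affine-combination {F = F} (a , b , F≡) κ p Σκ≡1 = begin
  F (λ c → sumF (λ i → κ i * p i c))
    ≡⟨ F≡ _ ⟩
  sumF (λ k → a k * sumF (λ i → κ i * p i k)) + b
    ≡⟨ cong₂ _+_ (sumF-cong (λ k → trans (*-distribˡ-sumF (a k) (λ i → κ i * p i k))
                                          (sumF-cong (λ i → swap-factors (a k) (κ i) (p i k)))))
                 (sym (*-identityʳ b)) ⟩
  sumF (λ k → sumF (λ i → κ i * (a k * p i k))) + b * 1ℚ
    ≡⟨ cong₂ _+_ (sumF-comm (λ k i → κ i * (a k * p i k))) (cong (b *_) (sym Σκ≡1)) ⟩
  sumF (λ i → sumF (λ k → κ i * (a k * p i k))) + b * sumF κ
    ≡⟨ cong₂ _+_ (sumF-cong (λ i → *-distribˡ-sumF (κ i) (λ k → a k * p i k)))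
                 (sym (*-distribˡ-sumF b κ)) ⟨
  sumF (λ i → κ i * sumF (λ k → a k * p i k)) + sumF (λ i → b * κ i)
    ≡⟨ sumF-distrib-+ (λ i → κ i * sumF (λ k → a k * p i k)) (λ i → b * κ i) ⟨
  sumF (λ i → κ i * sumF (λ k → a k * p i k) + b * κ i)
    ≡⟨ sumF-cong (λ i → trans (solve 3 (λ k s b → k :* s :+ b :* k := k :* (s :+ b)) refl (κ i) _ b)
                              (cong (κ i *_) (sym (F≡ (p i))))) ⟩
  sumF (λ i → κ i * F (p i)) ∎
  where
  swap-factors : ∀ a k q → a * (k * q) ≡ k * (a * q)
  swap-factors = solve 3 (λ a k q → a :* (k :* q) := k :* (a :* q)) refl

-- The last row cons 1ℚ (x ∘ e) is the combination 1 · (1, 0, …, 0) + Σ_c x_c · (0, basis c ∘ e).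
det-snoc-affine : ∀ {m n} (R : Fin m → Fin (suc m) → ℚ) (e : Fin m → Fin n) →
  AffineFunctional (λ x → det (snoc R (cons 1ℚ (λ k → x (e k)))))
det-snoc-affine {m} {n} R e = a , b , λ x → begin
  det (snoc R (cons 1ℚ (λ k → x (e k))))
    ≡⟨ det-snoc-linear R _ (cons 1ℚ x) rows (columns x) ⟩
  1ℚ * b + sumF (λ c → x c * a c)
    ≡⟨ cong (1ℚ * b +_) (sumF-cong (λ c → solve 2 (λ x a → x :* a := a :* x) refl (x c) (a c))) ⟩
  1ℚ * b + sumF (λ c → a c * x c)
    ≡⟨ solve 2 (λ b s → con 1ℚ :* b :+ s := s :+ b) refl b (sumF (λ c → a c * x c)) ⟩
  sumF (λ c → a c * x c) + b ∎
  where
  rows : Fin (suc n) → Fin (suc m) → ℚ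
  rows = cons (cons 1ℚ (λ _ → 0ℚ)) (λ c → cons 0ℚ (λ k → basis c (e k)))
  a : Point n
  a c = det (snoc R (rows (suc c)))
  b : ℚ
  b = det (snoc R (rows zero))
  columns : ∀ x c → cons 1ℚ (λ k → x (e k)) c ≡ sumF (λ l → cons 1ℚ x l * rows l c)
  columns x zero = begin
    1ℚ * 1ℚ + 0ℚ
      ≡⟨ cong (1ℚ * 1ℚ +_) (trans (sumF-cong (λ c → *-zeroʳ (x c))) (sumF-zero n)) ⟨
    1ℚ * 1ℚ + sumF (λ c → x c * 0ℚ) ∎
  columns x (suc k) = begin
    x (e k)                                    ≡⟨ sumF-basis x (e k) ⟨
    sumF (λ c → x c * basis c (e k))           ≡⟨ solve 1 (λ s → s := con 1ℚ :* con 0ℚ :+ s) refl _ ⟩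
    1ℚ * 0ℚ + sumF (λ c → x c * basis c (e k)) ∎

÷₀-as-* : ∀ p q → p ÷₀ q ≡ p * (1ℚ ÷₀ q)
÷₀-as-* p q with q ≟ 0ℚ
... | yes _ = sym (*-zeroʳ p)
... | no _  = cong (p *_) (sym (*-identityˡ _))

*-÷₀-inverse : ∀ {q} → q ≢ 0ℚ → q * (1ℚ ÷₀ q) ≡ 1ℚ
*-÷₀-inverse {q} q≢0 with q ≟ 0ℚ
... | yes q≡0 = contradiction q≡0 q≢0
... | no q≢0′ = trans (cong (q *_) (*-identityˡ _)) (*-inverseʳ q {{≢-nonZero q≢0′}})

÷₀-zeroˡ : ∀ q → 0ℚ ÷₀ q ≡ 0ℚ
÷₀-zeroˡ q = trans (÷₀-as-* 0ℚ q) (*-zeroˡ (1ℚ ÷₀ q))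

+-*-÷₀ : ∀ {q} p s → q ≢ 0ℚ → (p + s * q) ÷₀ q ≡ p ÷₀ q + s
+-*-÷₀ {q} p s q≢0 = begin
  (p + s * q) ÷₀ q    ≡⟨ ÷₀-as-* _ q ⟩
  (p + s * q) * w     ≡⟨ solve 4 (λ p s q w → (p :+ s :* q) :* w := p :* w :+ s :* (q :* w)) refl p s q w ⟩
  p * w + s * (q * w) ≡⟨ cong (λ r → p * w + s * r) (*-÷₀-inverse q≢0) ⟩
  p * w + s * 1ℚ      ≡⟨ cong₂ _+_ (÷₀-as-* p q) (sym (*-identityʳ s)) ⟨
  p ÷₀ q + s          ∎
  where
  w : ℚ
  w = 1ℚ ÷₀ q

affine-÷₀ : ∀ {n} {F : Point n → ℚ} → AffineFunctional F → ∀ q → AffineFunctional (λ x → F x ÷₀ q)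
affine-÷₀ {F = F} (a , b , F≡) q = (λ k → a k * w) , b * w , λ x → begin
  F x ÷₀ q                               ≡⟨ ÷₀-as-* (F x) q ⟩
  F x * w                                ≡⟨ cong (_* w) (F≡ x) ⟩
  (sumF (λ k → a k * x k) + b) * w       ≡⟨ solve 3 (λ s b w → (s :+ b) :* w := w :* s :+ b :* w) refl _ b w ⟩
  w * sumF (λ k → a k * x k) + b * w     ≡⟨ cong (_+ b * w) (*-distribˡ-sumF w (λ k → a k * x k)) ⟩
  sumF (λ k → w * (a k * x k)) + b * w   ≡⟨ cong (_+ b * w) (sumF-cong (λ k →
                                              solve 3 (λ w a x → w :* (a :* x) := a :* w :* x) refl w (a k) (x k))) ⟩
  sumF (λ k → a k * w * x k) + b * w     ∎
  where
  w : ℚ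
  w = 1ℚ ÷₀ q

IsUnitTriangular : ∀ {d} → (Point d → Point d) → Set
IsUnitTriangular {d} f = ∀ j x x′ → (∀ c → c < j → x c ≡ x′ c) → f x j - x j ≡ f x′ j - x′ j

-- Solve f x = y coordinatewise: after t rounds of x ↦ y - (f x - x) the first t coordinates are final.
unitTriangular⇒invertible : ∀ {d} {f : Point d → Point d} → IsUnitTriangular f → IsInvertible f
unitTriangular⇒invertible {d} {f} triangular = g , g∘f , f∘g
  where
  H : Fin d → Point d → ℚ
  H j x = f x j - x j
  approx : Point d → ℕ → Point d
  approx y = fold y (λ x c → y c - H c x)
  g : Point d → Point d
  g y = approx y d
  stable : ∀ y t c → toℕ c ℕ.< t → approx y (suc t) c ≡ approx y t c
  stable y (suc t) c c<t = cong (λ h → y c - h) (triangular c _ _ (λ c′ c′<c →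
    stable y t c′ (ℕ.<-≤-trans c′<c (ℕ.s≤s⁻¹ c<t))))
  exact : ∀ x t c → toℕ c ℕ.< t → approx (f x) t c ≡ x c
  exact x (suc t) c c<t = begin
    f x c - H c (approx (f x) t) ≡⟨ cong (λ h → f x c - h) (triangular c _ _ (λ c′ c′<c →
                                      exact x t c′ (ℕ.<-≤-trans c′<c (ℕ.s≤s⁻¹ c<t)))) ⟩
    f x c - (f x c - x c)        ≡⟨ solve 2 (λ a b → a :- (a :- b) := b) refl (f x c) (x c) ⟩
    x c                          ∎
  g∘f : ∀ x i → g (f x) i ≡ x i
  g∘f x i = exact x d i (toℕ<n i)
  f∘g : ∀ y i → f (g y) i ≡ y i
  f∘g y i = begin
    f (g y) i                     ≡⟨ solve 2 (λ a b → a := b :+ (a :- b)) refl (f (g y) i) (g y i) ⟩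
    g y i + H i (g y)             ≡⟨ cong (_+ H i (g y)) (stable y d i (toℕ<n i)) ⟨
    (y i - H i (g y)) + H i (g y) ≡⟨ solve 2 (λ a b → (a :- b) :+ b := a) refl (y i) (H i (g y)) ⟩
    y i                           ∎

-- Lattice sections of lattice-face simplices

vertices : ∀ {n} → (Fin (suc n) → Point n) → Permutation′ n → Fin n → Point n
vertices w τ r = w (inject₁ (τ ⟨$⟩ʳ r))

record AffineCombination {n} (p : Fin n → Point n) (j : Fin n) : Set where
  field
    size       : ℕ
    weight     : Fin size → ℚ
    vertex     : Fin size → Fin n
    vertex≤j   : ∀ i → vertex i ≤ j
    weight-sum : sumF weight ≡ 1ℚ

  point : Point n
  point c = sumF (λ i → weight i * p (vertex i) c)

open AffineCombination

-- The vertical line over the lattice point (z₀, …, z_{j-1}) meets the affine hull of the first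
-- j+1 coordinates of p₀, …, pⱼ in a lattice point (indices from 0).
LatticeSection : ∀ {n} → (Fin n → Point n) → Fin n → (Fin n → ℤ) → Set
LatticeSection p j z =
  Σ (AffineCombination p j) λ a → (∀ c → c < j → point a c ≡ ι (z c)) × IsInt (point a j)

HasLatticeSections : ∀ {n} → (Fin n → Point n) → Set
HasLatticeSections p = ∀ j z → LatticeSection p j z

section-fromℕ : ∀ {n} (p U : Fin (suc n) → Point (suc n)) (ρ : Fin (suc n) → Fin (suc n)) →
  (∀ i → p (ρ i) ≡ U i) → (z : Fin (suc n) → ℤ) →
  Σ ℤ (λ t → InAff U (snoc (λ c → ι (z (inject₁ c))) (ι t))) → LatticeSection p (fromℕ n) z
section-fromℕ {n} p U ρ pρ≡U z (t , λc , Σλc≡1 , λcU≡zt) =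
  a , below , (t , trans (point≡ (fromℕ n)) (snoc-last z′ (ι t)))
  where
  z′ : Fin n → ℚ
  z′ c = ι (z (inject₁ c))
  a : AffineCombination p (fromℕ n)
  a = record
    { size = suc n ; weight = λc ; vertex = ρ ; vertex≤j = λ i → ≤fromℕ (ρ i) ; weight-sum = Σλc≡1 }
  point≡ : ∀ c → point a c ≡ snoc z′ (ι t) c
  point≡ c = trans (sumF-cong (λ i → cong (λ q → λc i * q c) (pρ≡U i))) (λcU≡zt c)
  below : ∀ c → c < fromℕ n → point a c ≡ ι (z c)
  below c c<n with view c
  ... | ‵fromℕ      = contradiction c<n (ℕ.<-irrefl refl)
  ... | ‵inject₁ c′ = trans (point≡ (inject₁ c′)) (snoc-inject₁ z′ (ι t) c′)

section-inject₁ : ∀ {n} {p : Fin (suc n) → Point (suc n)} {p′ : Fin n → Point n} →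
  (∀ r c → p′ r c ≡ p (inject₁ r) (inject₁ c)) → ∀ {j} z →
  LatticeSection p′ j (λ c → z (inject₁ c)) → LatticeSection p (inject₁ j) z
section-inject₁ {n} {p} {p′} p′≡p {j} z (a′ , below′ , (t , a′ⱼ≡t)) =
  a , below , (t , trans (point≡ j) a′ⱼ≡t)
  where
  a : AffineCombination p (inject₁ j)
  a = record
    { size       = size a′
    ; weight     = weight a′
    ; vertex     = λ i → inject₁ (vertex a′ i)
    ; vertex≤j   = λ i → subst₂ ℕ._≤_ (sym (toℕ-inject₁ _)) (sym (toℕ-inject₁ j)) (vertex≤j a′ i)
    ; weight-sum = weight-sum a′
    }
  point≡ : ∀ c → point a (inject₁ c) ≡ point a′ c
  point≡ c = sumF-cong (λ i → cong (weight a′ i *_) (sym (p′≡p (vertex a′ i) c)))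
  below : ∀ c → c < inject₁ j → point a c ≡ ι (z c)
  below c c<j with view c
  ... | ‵fromℕ      =
    contradiction (subst₂ ℕ._<_ (toℕ-fromℕ n) (toℕ-inject₁ j) c<j) (ℕ.<-asym (toℕ<n j))
  ... | ‵inject₁ c′ =
    trans (point≡ c′) (below′ c′ (subst₂ ℕ._<_ (toℕ-inject₁ c′) (toℕ-inject₁ j) c<j))

facet-vertex : ∀ {n} (τ : Permutation′ (suc n)) (r : Fin n) →
  punchIn (inject₁ (τ ⟨$⟩ʳ fromℕ n)) (inject₁ (remove (fromℕ n) τ ⟨$⟩ʳ r)) ≡
  inject₁ (τ ⟨$⟩ʳ inject₁ r)
facet-vertex {n} τ r = begin
  punchIn (inject₁ (τ ⟨$⟩ʳ fromℕ n)) (inject₁ (remove (fromℕ n) τ ⟨$⟩ʳ r))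
    ≡⟨ punchIn-inject₁ _ _ ⟩
  inject₁ (punchIn (τ ⟨$⟩ʳ fromℕ n) (remove (fromℕ n) τ ⟨$⟩ʳ r))
    ≡⟨ cong inject₁ (punchIn-permute τ (fromℕ n) r) ⟨
  inject₁ (τ ⟨$⟩ʳ punchIn (fromℕ n) r)
    ≡⟨ cong (λ i → inject₁ (τ ⟨$⟩ʳ i)) (punchIn-fromℕ r) ⟩
  inject₁ (τ ⟨$⟩ʳ inject₁ r) ∎

-- The top section is the lattice-face condition for the facet of the first d vertices; the lower
-- ones come, by induction, from the projected facet opposite the last vertex in the order τ.
latticeFace⇒sections : ∀ {n} {w : Fin (suc (suc n)) → Point (suc n)} → LatticeFace n w →
  (τ : Permutation′ (suc n)) → HasLatticeSections (vertices w τ)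
latticeFace⇒sections {zero} {w} (_ , integral) τ zero z with integral (inject₁ (τ ⟨$⟩ʳ zero)) zero
... | t , w≡t = a , (λ _ ()) , (t , trans point≡vertex w≡t)
  where
  a : AffineCombination (vertices w τ) zero
  a = record
    { size = 1 ; weight = λ _ → 1ℚ ; vertex = λ _ → zero ; vertex≤j = λ _ → ℕ.z≤n ; weight-sum = refl }
  point≡vertex : point a zero ≡ vertices w τ zero zero
  point≡vertex = solve 1 (λ q → con 1ℚ :* q :+ con 0ℚ := q) refl _
latticeFace⇒sections {suc n} {w} (_ , facets) τ j z with view j
... | ‵fromℕ = section-fromℕ (vertices w τ) (λ i → w (punchIn (fromℕ _) i)) (τ ⟨$⟩ˡ_)
  (λ i → cong w (trans (cong inject₁ (inverseʳ τ)) (sym (punchIn-fromℕ i))))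
  z (proj₂ (facets (fromℕ _)) (λ c → z (inject₁ c)))
... | ‵inject₁ j′ = section-inject₁ (λ r c → cong (λ i → w i (inject₁ c)) (facet-vertex τ r)) z
  (latticeFace⇒sections (proj₁ (facets (inject₁ (τ ⟨$⟩ʳ fromℕ (suc n))))) (remove (fromℕ (suc n)) τ)
    j′ (λ c → z (inject₁ c)))

-- The map T_σ

ι-homo-− : ∀ a b → ι a - ι b ≡ ι (a ℤ.- b)
ι-homo-− a b = toℚᵘ-injective (ℚᵘ.≃-trans (toℚᵘ-homo-+ (ι a) (- ι b)) (ℚᵘ.≃-trans
  (ℚᵘ.+-cong (toℚᵘ-fromℚᵘ (mkℚᵘ a 0))
              (ℚᵘ.≃-trans (toℚᵘ-homo‿- (ι b)) (ℚᵘ.-‿cong (toℚᵘ-fromℚᵘ (mkℚᵘ b 0)))))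
  (ℚᵘ.≃-trans (*≡* numerators) (ℚᵘ.≃-sym (toℚᵘ-fromℚᵘ (mkℚᵘ (a ℤ.- b) 0))))))
  where
  numerators : (a ℤ.* ℤ.+ 1 ℤ.+ ℤ.- b ℤ.* ℤ.+ 1) ℤ.* ℤ.+ 1 ≡ (a ℤ.- b) ℤ.* ℤ.+ 1
  numerators = cong (ℤ._* ℤ.+ 1) (cong₂ ℤ._+_ (ℤ.*-identityʳ a) (ℤ.*-identityʳ (ℤ.- b)))

module _ {d : ℕ} (v : Fin (suc d) → Point d) (σ : Permutation′ d) where

  P : Fin d → Point d
  P = vertices v σ

  emb : (j : Fin d) → Fin (suc (toℕ j)) → Fin d
  emb j c = inject≤ c (toℕ<n j)

  emb-toℕ : ∀ j c → toℕ (emb j c) ≡ toℕ c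
  emb-toℕ j c = toℕ-inject≤ c (toℕ<n j)

  lift : (j : Fin d) → Point d → Fin (suc (suc (toℕ j))) → ℚ
  lift j x = cons 1ℚ (λ c → x (emb j c))

  rows : (j : Fin d) → Fin (suc (toℕ j)) → Fin (suc (suc (toℕ j))) → ℚ
  rows j r = lift j (P (emb j r))

  -- With k = toℕ j + 1, Xt v σ j x = X̃(σ,k;x) is definitionally snoc (rows j) (lift j x).
  detX : Fin d → Point d → ℚ
  detX j x = det (Xt v σ j x)

  detY : Fin d → ℚ
  detY j = det (Y v σ j)

  detX-affine : ∀ j → AffineFunctional (detX j)
  detX-affine j = det-snoc-affine (rows j) (emb j)

  detX-vertex : ∀ j r → r ≤ j → detX j (P r) ≡ 0ℚ
  detX-vertex j r r≤j = trans (det-snoc-cong (rows j) (λ c → cong (λ s → lift j (P s) c) (sym emb-r′)))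
                              (det-snoc-row (rows j) r′)
    where
    r′ : Fin (suc (toℕ j))
    r′ = fromℕ< (ℕ.s≤s r≤j)
    emb-r′ : emb j r′ ≡ r
    emb-r′ = toℕ-injective (trans (emb-toℕ j r′) (toℕ-fromℕ< (ℕ.s≤s r≤j)))

  detX-vanishes-on-combination : ∀ {J} j (a : AffineCombination P J) →
    (∀ i → detX j (P (vertex a i)) ≡ 0ℚ) → detX j (point a) ≡ 0ℚ
  detX-vanishes-on-combination j a vanish = begin
    detX j (point a)
      ≡⟨ affine-combination (detX-affine j) (weight a) (λ i → P (vertex a i)) (weight-sum a) ⟩
    sumF (λ i → weight a i * detX j (P (vertex a i)))
      ≡⟨ sumF-cong (λ i → trans (cong (weight a i *_) (vanish i)) (*-zeroʳ (weight a i))) ⟩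
    sumF {size a} (λ _ → 0ℚ)
      ≡⟨ sumF-zero (size a) ⟩
    0ℚ ∎

  detY-as-minor : ∀ j → det (λ i k → rows j i (inject₁ k)) ≡ detY j
  detY-as-minor j = det-cong entry
    where
    entry : ∀ i k → rows j i (inject₁ k) ≡ Y v σ j i k
    entry i zero    = refl
    entry i (suc k) = cong (P (emb j i)) (toℕ-injective
      (trans (emb-toℕ j (inject₁ k)) (trans (toℕ-inject₁ k) (sym (toℕ-inject≤ k _)))))

  lift-along : ∀ j x x′ → (∀ c → c < j → x c ≡ x′ c) →
    ∀ c → lift j x c ≡ lift j x′ c + (x j - x′ j) * basis (fromℕ (suc (toℕ j))) c
  lift-along j x x′ agree zero = solve 1 (λ s → con 1ℚ := con 1ℚ :+ s :* con 0ℚ) refl (x j - x′ j)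
  lift-along j x x′ agree (suc k) with view k
  ... | ‵fromℕ = begin
    x (emb j (fromℕ (toℕ j)))
      ≡⟨ cong x top ⟩
    x j
      ≡⟨ solve 2 (λ a b → a := b :+ (a :- b) :* con 1ℚ) refl (x j) (x′ j) ⟩
    x′ j + (x j - x′ j) * 1ℚ
      ≡⟨ cong₂ (λ c q → x′ c + (x j - x′ j) * q) top (cong ι (δ-diag (fromℕ (toℕ j)))) ⟨
    x′ (emb j (fromℕ (toℕ j))) + (x j - x′ j) * basis (fromℕ (toℕ j)) (fromℕ (toℕ j)) ∎
    where
    top : emb j (fromℕ (toℕ j)) ≡ j
    top = toℕ-injective (trans (emb-toℕ j (fromℕ (toℕ j))) (toℕ-fromℕ (toℕ j)))
  ... | ‵inject₁ k′ = begin
    x (emb j (inject₁ k′))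
      ≡⟨ agree (emb j (inject₁ k′)) below ⟩
    x′ (emb j (inject₁ k′))
      ≡⟨ solve 2 (λ a s → a := a :+ s :* con 0ℚ) refl _ (x j - x′ j) ⟩
    x′ (emb j (inject₁ k′)) + (x j - x′ j) * 0ℚ
      ≡⟨ cong (λ q → x′ (emb j (inject₁ k′)) + (x j - x′ j) * ι q)
              (δ-off-diag (fromℕ≢inject₁ {i = k′})) ⟨
    x′ (emb j (inject₁ k′)) + (x j - x′ j) * basis (fromℕ (toℕ j)) (inject₁ k′) ∎
    where
    below : emb j (inject₁ k′) < j
    below = subst (ℕ._< toℕ j) (sym (trans (emb-toℕ j (inject₁ k′)) (toℕ-inject₁ k′))) (toℕ<n k′)

  detX-along : ∀ j x x′ → (∀ c → c < j → x c ≡ x′ c) → detX j x ≡ detX j x′ + (x j - x′ j) * detY j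
  detX-along j x x′ agree = begin
    detX j x
      ≡⟨ det-snoc-+* (rows j) (x j - x′ j) (lift-along j x x′ agree) ⟩
    detX j x′ + (x j - x′ j) * det (snoc (rows j) (basis (fromℕ (suc (toℕ j)))))
      ≡⟨ cong (λ q → detX j x′ + (x j - x′ j) * q) (trans (det-snoc-basis-fromℕ (rows j)) (detY-as-minor j)) ⟩
    detX j x′ + (x j - x′ j) * detY j ∎

  detX-local : ∀ j x x′ → (∀ c → c ≤ j → x c ≡ x′ c) → detX j x ≡ detX j x′
  detX-local j x x′ agree = begin
    detX j x
      ≡⟨ detX-along j x x′ (λ c c<j → agree c (ℕ.<⇒≤ c<j)) ⟩
    detX j x′ + (x j - x′ j) * detY j
      ≡⟨ cong (λ q → detX j x′ + (q - x′ j) * detY j) (agree j ℕ.≤-refl) ⟩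
    detX j x′ + (x′ j - x′ j) * detY j
      ≡⟨ solve 3 (λ D a y → D :+ (a :- a) :* y := D) refl (detX j x′) (x′ j) (detY j) ⟩
    detX j x′ ∎

  detY-succ : ∀ J j → toℕ J ≡ suc (toℕ j) → detY J ≡ detX j (P J)
  detY-succ J j J≡ = det-cong-toℕ (Y v σ J) (Xt v σ j (P J)) (cong suc J≡) entry
    where
    row : ∀ i′ → Σ (Fin d) λ s → toℕ s ≡ toℕ i′ × Xt v σ j (P J) i′ ≡ lift j (P s)
    row i′ with view i′
    ... | ‵fromℕ     = J , trans J≡ (sym (toℕ-fromℕ _)) , snoc-last (rows j) (lift j (P J))
    ... | ‵inject₁ r =
      emb j r , trans (emb-toℕ j r) (sym (toℕ-inject₁ r)) , snoc-inject₁ (rows j) (lift j (P J)) r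
    Y-entry : ∀ i s k k′ → toℕ i ≡ toℕ s → toℕ k ≡ toℕ k′ → Y v σ J i k ≡ lift j (P s) k′
    Y-entry i s zero    zero     _   _    = refl
    Y-entry i s zero    (suc k′) _   ()
    Y-entry i s (suc k) zero     _   ()
    Y-entry i s (suc k) (suc k′) i≈s k≈k′ = cong₂ P (toℕ-injective (trans (emb-toℕ J i) i≈s))
      (toℕ-injective (trans (toℕ-inject≤ k _) (trans (ℕ.suc-injective k≈k′) (sym (emb-toℕ j k′)))))
    entry : ∀ i k i′ k′ → toℕ i ≡ toℕ i′ → toℕ k ≡ toℕ k′ →
      Y v σ J i k ≡ Xt v σ j (P J) i′ k′
    entry i k i′ k′ i≈i′ k≈k′ with row i′
    ... | s , s≈i′ , row≡ =
      trans (Y-entry i s k k′ (trans i≈i′ (sym s≈i′)) k≈k′) (sym (cong (λ r → r k′) row≡))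

  detY-step : HasLatticeSections P → ∀ J j → toℕ J ≡ suc (toℕ j) → detY J ≡ 0ℚ → detY j ≡ 0ℚ
  detY-step sections J j J≡ detY≡0 = begin
    detY j
      ≡⟨ solve 1 (λ y → y := con 0ℚ :+ (con 1ℚ :- con 0ℚ) :* y) refl (detY j) ⟩
    0ℚ + (1ℚ - 0ℚ) * detY j
      ≡⟨ cong₂ (λ p q → p + (ι q - 0ℚ) * detY j) (on-lattice (λ _ → ℤ.+ 0)) (δ-diag j) ⟨
    detX j origin + (basis j j - 0ℚ) * detY j
      ≡⟨ detX-along j (basis j) origin (λ c c<j →
           cong ι (δ-off-diag (λ j≡c → ℕ.<-irrefl (cong toℕ (sym j≡c)) c<j))) ⟨
    detX j (basis j)
      ≡⟨ on-lattice (δ j) ⟩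
    0ℚ ∎
    where
    origin : Point d
    origin c = ι (ℤ.+ 0)
    on-vertices : ∀ r → r ≤ J → detX j (P r) ≡ 0ℚ
    on-vertices r r≤J with ℕ.m≤n⇒m<n∨m≡n (subst (toℕ r ℕ.≤_) J≡ r≤J)
    ... | inj₁ r<J = detX-vertex j r (ℕ.s≤s⁻¹ r<J)
    ... | inj₂ r≡J = begin
      detX j (P r) ≡⟨ cong (detX j ∘ P) (toℕ-injective (trans r≡J (sym J≡))) ⟩
      detX j (P J) ≡⟨ detY-succ J j J≡ ⟨
      detY J       ≡⟨ detY≡0 ⟩
      0ℚ           ∎
    on-lattice : ∀ z → detX j (λ c → ι (z c)) ≡ 0ℚ
    on-lattice z with sections J z
    ... | a , below , _ = trans
      (detX-local j _ (point a) (λ c c≤j →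
        sym (below c (subst (suc (toℕ c) ℕ.≤_) (sym J≡) (ℕ.s≤s c≤j)))))
      (detX-vanishes-on-combination j a (λ i → on-vertices (vertex a i) (vertex≤j a i)))

  T-along : ∀ {j} x x′ → detY j ≢ 0ℚ → (∀ c → c < j → x c ≡ x′ c) →
    T v σ x j ≡ T v σ x′ j + (x j - x′ j)
  T-along {j} x x′ detY≢0 agree =
    trans (cong (_÷₀ detY j) (detX-along j x x′ agree)) (+-*-÷₀ (detX j x′) (x j - x′ j) detY≢0)

  T-affine : IsAffine (T v σ)
  T-affine = affine-rows (λ j → affine-÷₀ (detX-affine j) (detY j))

  T-unitTriangular : (∀ j → detY j ≢ 0ℚ) → IsUnitTriangular (T v σ)
  T-unitTriangular detY≢0 j x x′ agree = begin
    T v σ x j - x j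
      ≡⟨ cong (_- x j) (T-along x x′ (detY≢0 j) agree) ⟩
    T v σ x′ j + (x j - x′ j) - x j
      ≡⟨ solve 3 (λ t a b → t :+ (a :- b) :- a := t :- b) refl (T v σ x′ j) (x j) (x′ j) ⟩
    T v σ x′ j - x′ j ∎

  T-integral : (∀ j → detY j ≢ 0ℚ) → HasLatticeSections P → ∀ z j → IsInt (T v σ (λ c → ι (z c)) j)
  T-integral detY≢0 sections z j with sections j z
  ... | a , below , t , aⱼ≡t = z j ℤ.- t , (begin
    T v σ (λ c → ι (z c)) j                   ≡⟨ T-along _ (point a) (detY≢0 j) (λ c → sym ∘ below c) ⟩
    T v σ (point a) j + (ι (z j) - point a j) ≡⟨ cong₂ (λ p q → p + (ι (z j) - q)) T-at-a aⱼ≡t ⟩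
    0ℚ + (ι (z j) - ι t)                      ≡⟨ +-identityˡ _ ⟩
    ι (z j) - ι t                             ≡⟨ ι-homo-− (z j) t ⟩
    ι (z j ℤ.- t)                             ∎)
    where
    T-at-a : T v σ (point a) j ≡ 0ℚ
    T-at-a = trans (cong (_÷₀ detY j) (detX-vanishes-on-combination j a λ i →
                                        detX-vertex j (vertex a i) (vertex≤j a i)))
                   (÷₀-zeroˡ (detY j))

detY≢0 : ∀ {m} (v : Fin (suc (suc m)) → Point (suc m)) (σ : Permutation′ (suc m)) →
  HasLatticeSections (vertices v σ) → ∀ j → detY v σ j ≢ 0ℚ
-- Y(σ,1) is the 1×1 matrix (1), so detY v σ zero computes to 1ℚ.
detY≢0 v σ sections = <-weakInduction (λ j → detY v σ j ≢ 0ℚ) (λ ())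
  (λ j detYⱼ≢0 → detYⱼ≢0 ∘ detY-step v σ sections (suc j) (inject₁ j) (cong suc (sym (toℕ-inject₁ j))))

proposition5p2 : (m : ℕ) → (v : Fin (suc (suc m)) → Point (suc m))
    → LatticeFace m v → (σ : Permutation′ (suc m))
    → LatticePreserving (T v σ)
proposition5p2 m v lf σ =
  T-affine v σ , unitTriangular⇒invertible (T-unitTriangular v σ nonzero) , T-integral v σ nonzero sections
  where
  sections : HasLatticeSections (vertices v σ)
  sections = latticeFace⇒sections lf σ
  nonzero : ∀ j → detY v σ j ≢ 0ℚ
  nonzero = detY≢0 v σ sections
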